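{- Let $O$ and $I$ be types and let $R\subseteq O\times I^*$ be a relation between outputs and finite lists over $I$. Then the following are equivalent: (i) $R$ is left-unique, i.e. for all $a,b\in O$ and $l\in I^*$, $R\,a\,l$ and $R\,b\,l$ imply $a=b$, and moreover for all $a,b\in O$ and $l,l'\in I^*$, $R\,a\,l$ and $R\,b\,(l+\!\!+l')$ imply $l'=[\,]$; (ii) $R$ is strongly unique, i.e. for all $a,b\in O$ and $l_a,l_a',l_b,l_b'\in I^*$, if $l_a+\!\!+l_a'=l_b+\!\!+l_b'$, $R\,a\,l_a$ and $R\,b\,l_b$, then $a=b$ and $l_a=l_b$.
   Context: $I^*$ denotes finite lists over $I$, $[\,]$ the empty list, and $+\!\!+$ list concatenation. -}

module Defs where

open import Level using (Level; _⊔_)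
open import Data.List using (List; []; _++_)
open import Data.Product using (_×_)
open import Relation.Binary.PropositionalEquality using (_≡_)

LeftUnique : ∀ {o i r} {O : Set o} {I : Set i} → (O → List I → Set r) → Set (o ⊔ i ⊔ r)
LeftUnique {O = O} {I = I} R =
  ((a b : O) (l : List I) → R a l → R b l → a ≡ b) ×
  ((a b : O) (l l′ : List I) → R a l → R b (l ++ l′) → l′ ≡ [])

StronglyUnique : ∀ {o i r} {O : Set o} {I : Set i} → (O → List I → Set r) → Set (o ⊔ i ⊔ r)
StronglyUnique {O = O} {I = I} R =
  (a b : O) (la la′ lb lb′ : List I) →
  la ++ la′ ≡ lb ++ lb′ → R a la → R b lb → (a ≡ b) × (la ≡ lb)

-- The only fact about lists the argument needs is that the free monoid I* is
-- equidivisible: if la ++ la′ ≡ lb ++ lb′ then one of la, lb is a prefix of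
-- the other.  Given that:
--   (i) ⇒ (ii)  two related lists with a common extension are comparable, so
--               one is the other extended by some k; the second clause of
--               left-uniqueness forces k ≡ [], hence la ≡ lb, and then the
--               first clause gives a ≡ b.
--   (ii) ⇒ (i)  both clauses are instances of strong uniqueness, with the
--               common extensions l ++ [] and l ++ l′ respectively.
module Submission where

open import Defs
open import Data.List using (List; []; _∷_; _++_)
open import Data.List.Properties
  using (++-identityʳ; ++-identityʳ-unique; ∷-injectiveˡ; ∷-injectiveʳ)
open import Data.Product using (_×_; _,_; ∃; proj₁; proj₂)
open import Data.Sum using (_⊎_; inj₁; inj₂)
open import Function.Bundles using (_⇔_; mk⇔)
open import Relation.Binary.PropositionalEquality using (_≡_; refl; sym; cong)

++-equidivisible : ∀ {i} {I : Set i} (xs ys us vs : List I) →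
  xs ++ ys ≡ us ++ vs →
  (∃ λ k → us ≡ xs ++ k) ⊎ (∃ λ k → xs ≡ us ++ k)
++-equidivisible []       ys us       vs e = inj₁ (us , refl)
++-equidivisible (x ∷ xs) ys []       vs e = inj₂ (x ∷ xs , refl)
++-equidivisible (x ∷ xs) ys (u ∷ us) vs e
  with refl ← ∷-injectiveˡ e
  with ++-equidivisible xs ys us vs (∷-injectiveʳ e)
... | inj₁ (k , us≡xs++k) = inj₁ (k , cong (x ∷_) us≡xs++k)
... | inj₂ (k , xs≡us++k) = inj₂ (k , cong (x ∷_) xs≡us++k)

module _ {o i r} {O : Set o} {I : Set i} {R : O → List I → Set r} where

  extension-trivial : LeftUnique R → ∀ a b l k →
    R a l → R b (l ++ k) → (a ≡ b) × (l ≡ l ++ k)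
  extension-trivial (sameList , noExtension) a b l k ra rb
    with refl ← noExtension a b l k ra rb
    rewrite ++-identityʳ l
    = sameList a b l ra rb , refl

  leftUnique⇒stronglyUnique : LeftUnique R → StronglyUnique R
  leftUnique⇒stronglyUnique lu a b la la′ lb lb′ e ra rb
    with ++-equidivisible la la′ lb lb′ e
  ... | inj₁ (k , refl) = extension-trivial lu a b la k ra rb
  ... | inj₂ (k , refl) with extension-trivial lu b a lb k rb ra
  ...   | b≡a , lb≡lb++k = sym b≡a , sym lb≡lb++k

  stronglyUnique⇒leftUnique : StronglyUnique R → LeftUnique R
  stronglyUnique⇒leftUnique su = sameList , noExtension
    where
    sameList : ∀ a b l → R a l → R b l → a ≡ b
    sameList a b l ra rb = proj₁ (su a b l [] l [] refl ra rb)

    noExtension : ∀ a b l l′ → R a l → R b (l ++ l′) → l′ ≡ []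
    noExtension a b l l′ ra rb = ++-identityʳ-unique l
      (proj₂ (su a b l l′ (l ++ l′) [] (sym (++-identityʳ (l ++ l′))) ra rb))

mainTheorem4 : ∀ {o i r} (O : Set o) (I : Set i) (R : O → List I → Set r) →
    LeftUnique R ⇔ StronglyUnique R
mainTheorem4 O I R = mk⇔ leftUnique⇒stronglyUnique stronglyUnique⇒leftUnique
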